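{- Let $G=(V,E)$ be a trivalent $2$-edge-connected graph. If $A\subseteq V$ and $v\in V- A$ is a vertex contained in a cycle of the induced subgraph $G[V- A]$, then $r_{M_G}(A\cup\{v\})>r_{M_G}(A)$. In particular, if $A$ is a basis of $M_G$, then $V- A$ is acyclic.
   Context: Graphs are finite and undirected and may have parallel edges; trivalent means every vertex has degree $3$. A set of distinct vertices $\{v_1,\dots,v_r\}$ is a cycle if, after relabeling, $v_i$ and $v_{i+1}$ are adjacent for all $i$, where $v_{r+1}=v_1$. A vertex subset is acyclic if its induced subgraph contains no cycle. $r^*$ is the rank function of the bond (cographic) matroid of $G$. For $A\subseteq V$, $\delta(A)$ is the set of edges incident to at least one vertex of $A$. The graph curve matroid $M_G$ is the matroid on $V$ whose circuits are the non-empty subsets $A\subseteq V$ that are inclusion-minimal among non-empty subsets satisfying $r^*(\delta(A))\le|A|$. $r_{M_G}$ denotes its rank function. -}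

module Defs where

open import Data.Nat using (ℕ; zero; suc; _+_; _≤_; _<_)
open import Data.Fin using (Fin; zero; suc; inject₁; fromℕ) renaming (_≟_ to _≟ᶠ_)
open import Data.Fin.Subset using (Subset; _∈_; _∉_; _⊆_; _⊂_; ∁; ⁅_⁆; ∣_∣; Nonempty; _∪_)
open import Data.Vec using (tabulate; lookup)
open import Data.Bool using (Bool; true; false; if_then_else_; _∨_)
open import Data.List using (List; map; allFin)
open import Data.Nat.ListAction using (sum)
open import Data.Product using (Σ; ∃; _×_; _,_)
open import Data.Sum using (_⊎_)
open import Relation.Nullary using (¬_; does)
open import Relation.Binary.PropositionalEquality using (_≡_)
open import Function.Definitions using (Injective)

-- Finite multigraphs: vertices Fin n, edges Fin m, each edge has two
-- endpoints (parallel edges allowed; loops are representable but are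
-- excluded by trivalence + 2-edge-connectivity).

record Graph (n m : ℕ) : Set where
  field
    src : Fin m → Fin n
    tgt : Fin m → Fin n
open Graph public

module _ {n m : ℕ} (G : Graph n m) where

  Joins : Fin m → Fin n → Fin n → Set
  Joins e x y = (src G e ≡ x × tgt G e ≡ y) ⊎ (src G e ≡ y × tgt G e ≡ x)

  -- degree (a loop would count twice)
  deg : Fin n → ℕ
  deg v = sum (map (λ e → (if does (src G e ≟ᶠ v) then 1 else 0)
                         + (if does (tgt G e ≟ᶠ v) then 1 else 0))
                   (allFin m))

  Trivalent : Set
  Trivalent = ∀ v → deg v ≡ 3

  data Conn (F : Subset m) : Fin n → Fin n → Set where
    here : ∀ {x} → Conn F x x
    step : ∀ {x y z} e → e ∈ F → Joins e x y → Conn F y z → Conn F x z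

  Connected : Set
  Connected = ∀ x y → Conn Data.Fin.Subset.⊤ x y

  TwoEdgeConnected : Set
  TwoEdgeConnected = Connected × (∀ e x y → Conn (∁ ⁅ e ⁆) x y)

  record Cycle : Set where
    field
      len   : ℕ
      verts : Fin (suc len) → Fin n
      edges : Fin (suc len) → Fin m
      verts-inj : Injective _≡_ _≡_ verts
      edges-inj : Injective _≡_ _≡_ edges
      joins-step : ∀ (i : Fin len) →
        Joins (edges (inject₁ i)) (verts (inject₁ i)) (verts (suc i))
      joins-last : Joins (edges (fromℕ len)) (verts (fromℕ len)) (verts zero)
  open Cycle public

  -- the cycle lies in the induced subgraph G[S]
  CycleIn : Subset n → Cycle → Set
  CycleIn S C = ∀ i → verts C i ∈ S

  Acyclic : Subset n → Set
  Acyclic S = ¬ (Σ Cycle λ C → CycleIn S C)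

  -- Bond (cographic) matroid: I ⊆ E is independent iff E - I is spanning
  -- in the cycle matroid, i.e. the endpoints of every edge are connected
  -- in (V, E - I).
  CoIndep : Subset m → Set
  CoIndep I = ∀ e x y → Joins e x y → Conn (∁ I) x y

  δ : Subset n → Subset m
  δ A = tabulate (λ e → lookup A (src G e) ∨ lookup A (tgt G e))

  -- r*(δ(A)) ≤ |A|, with r* the maximum size of a coindependent subset
  RankCond : Subset n → Set
  RankCond A = ∀ I → I ⊆ δ A → CoIndep I → ∣ I ∣ ≤ ∣ A ∣

  -- circuits of the graph curve matroid M_G
  Circuit : Subset n → Set
  Circuit A = Nonempty A × RankCond A
            × (∀ B → Nonempty B → B ⊂ A → ¬ RankCond B)

  Indep : Subset n → Set
  Indep X = ∀ A → A ⊆ X → ¬ Circuit A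

  Basis : Subset n → Set
  Basis X = Indep X × (∀ Y → X ⊆ Y → Indep Y → Y ⊆ X)

  -- r_{M_G}(X) < r_{M_G}(Y), where r_{M_G}(Z) is the maximum size of an
  -- independent subset of Z: some independent subset of Y is strictly
  -- larger than every independent subset of X.
  RankLt : Subset n → Subset n → Set
  RankLt X Y = Σ (Subset n) λ I → I ⊆ Y × Indep I
             × (∀ J → J ⊆ X → Indep J → ∣ J ∣ < ∣ I ∣)

module Submission where

-- Let v lie on a cycle Z of G avoiding A. Adding v to an independent J ⊆ A keeps it
-- independent: a circuit C ⊆ J ∪ {v} must contain v, and then B = C ∩ A would violate the
-- minimality of C. Indeed B satisfies the rank condition, since a coindependent I ⊆ δ(B)
-- avoids the cycle (which lies outside A), so I plus a cycle edge at v is a coindependent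
-- subset of δ(C). And B is nonempty, since in a trivalent 2-edge-connected graph a cycle
-- edge at v together with the edge at v off the cycle is coindependent, forcing |C| ≥ 2.
-- Applied to a largest independent subset of A this gives the rank increase, and applied
-- to a basis A it shows that ∁ A contains no cycle.

open import Defs
open import Data.Bool using (true; false; _∨_; if_then_else_)
open import Data.Bool.Properties using (∨-zeroʳ)
open import Data.Empty using (⊥-elim)
open import Data.Fin using (Fin; zero; suc; toℕ; fromℕ<; punchIn; punchOut) renaming (_≟_ to _≟ᶠ_)
open import Data.Fin.Properties using (all?; any?; toℕ-injective; toℕ-fromℕ; toℕ-fromℕ<; toℕ-inject₁; toℕ<n; punchIn-punchOut; punchInᵢ≢i; punchIn-injective; punchOut-injective)
open import Data.Fin.Subset using (Subset; _∈_; _∉_; _⊆_; _⊂_; ∁; ⁅_⁆; ∣_∣; Nonempty; _∪_; _∩_; inside; outside)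
open import Data.Fin.Subset.Properties using (_∈?_; _⊆?_; _⊂?_; nonempty?; anySubset?; Empty-unique; ∣⊥∣≡0; ∉⊥; ⊆-min; ∣p∣≤n; ∣⁅x⁆∣≡1; p⊆q⇒∣p∣≤∣q∣; p⊂q⇒∣p∣<∣q∣; x∈⁅x⁆; x∈⁅y⁆⇒x≡y; x∈p∪q⁺; x∈p∪q⁻; p⊆p∪q; q⊆p∪q; x∈p∩q⁺; p∩q⊆p; p∩q⊆q; x∈∁p⇒x∉p; x∉p⇒x∈∁p)
import Data.Fin.Subset as Subset
open import Data.List using (map; allFin)
import Data.List as List
open import Data.List.Properties using (map-tabulate)
import Data.Nat.ListAction as ListAction
open import Data.Nat using (ℕ; zero; suc; _+_; _≤_; _<_; z≤n; s≤s; _≤?_; _<?_)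
open import Data.Nat.Properties using (≤-refl; ≤-reflexive; ≤-trans; <⇒≤; <⇒≢; ≤⇒≯; ≮⇒≥; ≰⇒>; n≤1+n; m≤m+n; m≤n+m; m<n⇒m<1+n; ≤-pred; <-≤-trans; ≤-<-trans; +-suc; +-assoc; +-identityʳ; +-monoʳ-≤; +-mono-≤; +-cancelˡ-<; m≤n⇒m<n∨m≡n; m⊓n≤n; m≤n⇒m⊓n≡m; +-0-commutativeMonoid; module ≤-Reasoning)
open import Algebra.Properties.CommutativeMonoid.Sum +-0-commutativeMonoid using (sum; sum-remove)
open import Data.Product using (Σ; ∃; _×_; _,_; proj₂)
open import Data.Sum using (_⊎_; inj₁; inj₂; [_,_]′)
open import Data.Vec using ([]; _∷_; lookup)
open import Data.Vec.Functional using (removeAt)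
open import Data.Vec.Properties using ([]=⇒lookup; lookup⇒[]=; lookup∘tabulate)
open import Function using (_∘_; id)
open import Relation.Nullary using (¬_; Dec; yes; no; does; contradiction)
open import Relation.Nullary.Decidable using (_×-dec_; _⊎-dec_; _→-dec_; ¬?; dec-true; dec-false; decidable-stable)
open import Relation.Binary.PropositionalEquality using (_≡_; _≢_; refl; sym; trans; cong; cong₂; subst; subst₂)

sum-tabulate : ∀ {m} (f : Fin m → ℕ) → ListAction.sum (List.tabulate f) ≡ sum f
sum-tabulate {zero}  f = refl
sum-tabulate {suc m} f = cong (f zero +_) (sum-tabulate (f ∘ suc))

sum-allFin : ∀ {m} (f : Fin m → ℕ) → ListAction.sum (map f (allFin m)) ≡ sum f
sum-allFin {m} f = trans (cong ListAction.sum (map-tabulate id f)) (sum-tabulate f)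

sum-positive : ∀ {m} (f : Fin m → ℕ) → 0 < sum f → ∃ λ i → 0 < f i
sum-positive {suc m} f 0<sum with f zero in eq
... | suc _ = zero , subst (0 <_) (sym eq) (s≤s z≤n)
... | zero  with sum-positive (f ∘ suc) 0<sum
...   | i , 0<fi = suc i , 0<fi

f≤sum : ∀ {m} (f : Fin m → ℕ) i → f i ≤ sum f
f≤sum {suc m} f i = subst (f i ≤_) (sym (sum-remove f)) (m≤m+n (f i) _)

pair≤sum : ∀ {m} (f : Fin m → ℕ) {i j} → i ≢ j → f i + f j ≤ sum f
pair≤sum {suc m} f {i} {j} i≢j = begin
  f i + f j                         ≡⟨ cong (λ k → f i + f k) (punchIn-punchOut i≢j) ⟨
  f i + removeAt f i (punchOut i≢j) ≤⟨ +-monoʳ-≤ (f i) (f≤sum (removeAt f i) _) ⟩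
  f i + sum (removeAt f i)          ≡⟨ sum-remove f ⟨
  sum f                             ∎
  where open ≤-Reasoning

triple≤sum : ∀ {m} (f : Fin m → ℕ) {i j k} → i ≢ j → i ≢ k → j ≢ k →
             f i + f j + f k ≤ sum f
triple≤sum {suc m} f {i} {j} {k} i≢j i≢k j≢k = begin
  f i + f j + f k       ≡⟨ +-assoc (f i) (f j) (f k) ⟩
  f i + (f j + f k)     ≡⟨ cong₂ (λ a b → f i + (f a + f b)) (punchIn-punchOut i≢j) (punchIn-punchOut i≢k) ⟨
  f i + (g j′ + g k′)   ≤⟨ +-monoʳ-≤ (f i) (pair≤sum g (j≢k ∘ punchOut-injective i≢j i≢k)) ⟩
  f i + sum g           ≡⟨ sum-remove f ⟨
  sum f                 ∎
  where
  open ≤-Reasoning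
  g = removeAt f i
  j′ = punchOut i≢j
  k′ = punchOut i≢k

positive-elsewhere : ∀ {m} (f : Fin m → ℕ) {i} → f i < sum f → ∃ λ j → j ≢ i × 0 < f j
positive-elsewhere {suc m} f {i} fi<sum
  with sum-positive (removeAt f i) (+-cancelˡ-< (f i) 0 _ (begin-strict
    f i + 0                  ≡⟨ +-identityʳ (f i) ⟩
    f i                      <⟨ fi<sum ⟩
    sum f                    ≡⟨ sum-remove f ⟩
    f i + sum (removeAt f i) ∎))
  where open ≤-Reasoning
... | j , 0<fj = punchIn i j , punchInᵢ≢i i j , 0<fj

positive-elsewhere₂ : ∀ {m} (f : Fin m → ℕ) {i j} → i ≢ j → f i + f j < sum f →
                      ∃ λ k → k ≢ i × k ≢ j × 0 < f k
positive-elsewhere₂ {suc m} f {i} {j} i≢j fi+fj<sum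
  with positive-elsewhere g {j′} (+-cancelˡ-< (f i) _ _ (begin-strict
    f i + g j′  ≡⟨ cong (λ k → f i + f k) (punchIn-punchOut i≢j) ⟩
    f i + f j   <⟨ fi+fj<sum ⟩
    sum f       ≡⟨ sum-remove f ⟩
    f i + sum g ∎))
  where
  open ≤-Reasoning
  g = removeAt f i
  j′ = punchOut i≢j
... | k , k≢j′ , 0<fk =
  punchIn i k , punchInᵢ≢i i k ,
  k≢j′ ∘ punchIn-injective i k _ ∘ (λ eq → trans eq (sym (punchIn-punchOut i≢j))) , 0<fk

∣p∪q∣≤∣p∣+∣q∣ : ∀ {n} (p q : Subset n) → ∣ p ∪ q ∣ ≤ ∣ p ∣ + ∣ q ∣
∣p∪q∣≤∣p∣+∣q∣ []            []            = z≤n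
∣p∪q∣≤∣p∣+∣q∣ (inside  ∷ p) (inside  ∷ q) =
  s≤s (≤-trans (∣p∪q∣≤∣p∣+∣q∣ p q) (≤-trans (n≤1+n _) (≤-reflexive (sym (+-suc ∣ p ∣ ∣ q ∣)))))
∣p∪q∣≤∣p∣+∣q∣ (inside  ∷ p) (outside ∷ q) = s≤s (∣p∪q∣≤∣p∣+∣q∣ p q)
∣p∪q∣≤∣p∣+∣q∣ (outside ∷ p) (inside  ∷ q) =
  ≤-trans (s≤s (∣p∪q∣≤∣p∣+∣q∣ p q)) (≤-reflexive (sym (+-suc ∣ p ∣ ∣ q ∣)))
∣p∪q∣≤∣p∣+∣q∣ (outside ∷ p) (outside ∷ q) = ∣p∪q∣≤∣p∣+∣q∣ p q

∣p∣<∣p∪⁅x⁆∣ : ∀ {n} {p : Subset n} {x} → x ∉ p → ∣ p ∣ < ∣ p ∪ ⁅ x ⁆ ∣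
∣p∣<∣p∪⁅x⁆∣ {x = x} x∉p = p⊂q⇒∣p∣<∣q∣ (p⊆p∪q ⁅ x ⁆ , x , q⊆p∪q _ ⁅ x ⁆ (x∈⁅x⁆ x) , x∉p)

0<∣p∣⇒Nonempty : ∀ {n} {p : Subset n} → 0 < ∣ p ∣ → Nonempty p
0<∣p∣⇒Nonempty {n} {p} 0<∣p∣ with nonempty? p
... | yes ne = ne
... | no ¬ne = contradiction (trans (cong ∣_∣ (Empty-unique ¬ne)) (∣⊥∣≡0 n)) (<⇒≢ 0<∣p∣ ∘ sym)

∪-monoˡ-⊆ : ∀ {n} {p q : Subset n} r → p ⊆ q → p ∪ r ⊆ q ∪ r
∪-monoˡ-⊆ {p = p} r p⊆q x∈ = [ x∈p∪q⁺ ∘ inj₁ ∘ p⊆q , x∈p∪q⁺ ∘ inj₂ ]′ (x∈p∪q⁻ p r x∈)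

p⊆q∪⁅x⁆∧x∉p⇒p⊆q : ∀ {n} {p q : Subset n} {x} → p ⊆ q ∪ ⁅ x ⁆ → x ∉ p → p ⊆ q
p⊆q∪⁅x⁆∧x∉p⇒p⊆q {q = q} {x} p⊆ x∉p {y} y∈ with x∈p∪q⁻ q ⁅ x ⁆ (p⊆ y∈)
... | inj₁ y∈q = y∈q
... | inj₂ y∈x = contradiction (subst (_∈ _) (x∈⁅y⁆⇒x≡y x y∈x) y∈) x∉p

allSubset? : ∀ {n} {P : Subset n → Set} → (∀ p → Dec (P p)) → Dec (∀ p → P p)
allSubset? P? with anySubset? (¬? ∘ P?)
... | yes (p , ¬Pp) = no λ ∀P → ¬Pp (∀P p)
... | no ∄¬P        = yes λ p → decidable-stable (P? p) (λ ¬Pp → ∄¬P (p , ¬Pp))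

module _ {n} {P Done : Subset n → Set}
         (progress : ∀ {p} → P p → Done p ⊎ ∃ λ q → P q × ∣ p ∣ < ∣ q ∣) where

  grow : ∀ {p} → P p → ∃ λ q → P q × Done q
  grow {p} = go n (m≤m+n n ∣ p ∣)
    where
    go : ∀ d {p} → n ≤ d + ∣ p ∣ → P p → ∃ λ q → P q × Done q
    go zero    bound Pp with progress Pp
    ... | inj₁ done           = _ , Pp , done
    ... | inj₂ (q , _ , p<q)  = contradiction (<-≤-trans p<q (∣p∣≤n q)) (≤⇒≯ bound)
    go (suc d) {p} bound Pp with progress Pp
    ... | inj₁ done           = _ , Pp , done
    ... | inj₂ (q , Pq , p<q) =
      go d (≤-trans bound (≤-trans (≤-reflexive (sym (+-suc d ∣ p ∣))) (+-monoʳ-≤ d p<q))) Pq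

largest : ∀ {n} {P : Subset n → Set} → (∀ p → Dec (P p)) → ∀ {p} → P p →
          ∃ λ q → P q × ∀ r → P r → ∣ r ∣ ≤ ∣ q ∣
largest {P = P} P? = grow progress
  where
  progress : ∀ {p} → P p → (∀ r → P r → ∣ r ∣ ≤ ∣ p ∣) ⊎ ∃ λ q → P q × ∣ p ∣ < ∣ q ∣
  progress {p} _ with anySubset? (λ q → P? q ×-dec (∣ p ∣ <? ∣ q ∣))
  ... | yes larger = inj₂ larger
  ... | no ∄larger = inj₁ λ r Pr → ≮⇒≥ λ p<r → ∄larger (r , Pr , p<r)

module GraphProperties {n m : ℕ} (G : Graph n m) where

  Joins-sym : ∀ {e x y} → Joins G e x y → Joins G e y x
  Joins-sym (inj₁ (s , t)) = inj₂ (s , t)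
  Joins-sym (inj₂ (s , t)) = inj₁ (s , t)

  Joins-endpoint : ∀ {e x y w z} → Joins G e x y → Joins G e w z → w ≡ x ⊎ w ≡ y
  Joins-endpoint (inj₁ (refl , refl)) (inj₁ (refl , _)) = inj₁ refl
  Joins-endpoint (inj₁ (refl , refl)) (inj₂ (_ , refl)) = inj₂ refl
  Joins-endpoint (inj₂ (refl , refl)) (inj₁ (refl , _)) = inj₂ refl
  Joins-endpoint (inj₂ (refl , refl)) (inj₂ (_ , refl)) = inj₁ refl

  joins? : ∀ e x y → Dec (Joins G e x y)
  joins? e x y = ((src G e ≟ᶠ x) ×-dec (tgt G e ≟ᶠ y)) ⊎-dec ((src G e ≟ᶠ y) ×-dec (tgt G e ≟ᶠ x))

  module _ {F : Subset m} where

    infixr 5 _++_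
    _++_ : ∀ {x y z} → Conn G F x y → Conn G F y z → Conn G F x z
    here           ++ q = q
    step e e∈ j p ++ q = step e e∈ j (p ++ q)

    Conn-edge : ∀ {e x y} → e ∈ F → Joins G e x y → Conn G F x y
    Conn-edge e∈ j = step _ e∈ j here

    Conn-sym : ∀ {x y} → Conn G F x y → Conn G F y x
    Conn-sym here            = here
    Conn-sym (step e e∈ j p) = Conn-sym p ++ Conn-edge e∈ (Joins-sym j)

    Conn-along : ∀ {e a b x y} → Joins G e a b → Joins G e x y → Conn G F a b → Conn G F x y
    Conn-along (inj₁ (refl , refl)) (inj₁ (refl , refl)) p = p
    Conn-along (inj₁ (refl , refl)) (inj₂ (refl , refl)) p = Conn-sym p
    Conn-along (inj₂ (refl , refl)) (inj₁ (refl , refl)) p = Conn-sym p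
    Conn-along (inj₂ (refl , refl)) (inj₂ (refl , refl)) p = p

    Conn-trapped : ∀ {w c} → (∀ {e y} → e ∈ F → Joins G e w y → y ≡ w) → Conn G F w c → c ≡ w
    Conn-trapped stuck here                = refl
    Conn-trapped stuck (step e e∈ j p) with stuck e∈ j
    ... | refl = Conn-trapped stuck p

    Closed : Subset n → Set
    Closed S = ∀ {e a b} → e ∈ F → Joins G e a b → a ∈ S → b ∈ S

    Conn-closed : ∀ {S a b} → Closed S → Conn G F a b → a ∈ S → b ∈ S
    Conn-closed cl here            a∈ = a∈
    Conn-closed cl (step e e∈ j p) a∈ = Conn-closed cl p (cl e∈ j a∈)

    reachable : ∀ x → ∃ λ S → (x ∈ S × ∀ {y} → y ∈ S → Conn G F x y) × Closed S
    reachable x = grow progress (x∈⁅x⁆ x , λ y∈ → subst (Conn G F x) (sym (x∈⁅y⁆⇒x≡y x y∈)) here)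
      where
      progress : ∀ {S} → x ∈ S × (∀ {y} → y ∈ S → Conn G F x y) →
                 Closed S ⊎ ∃ λ S′ → (x ∈ S′ × ∀ {y} → y ∈ S′ → Conn G F x y) × ∣ S ∣ < ∣ S′ ∣
      progress {S} (x∈S , reach) with any? (λ e → any? λ a → any? λ b →
        (e ∈? F) ×-dec (joins? e a b ×-dec ((a ∈? S) ×-dec ¬? (b ∈? S))))
      ... | no ∄leaving = inj₁ λ {e} {a} {b} e∈ j a∈ →
        decidable-stable (b ∈? S) λ b∉ → ∄leaving (e , a , b , e∈ , j , a∈ , b∉)
      ... | yes (e , a , b , e∈ , j , a∈ , b∉) =
        inj₂ (S ∪ ⁅ b ⁆ , (p⊆p∪q ⁅ b ⁆ x∈S , reach′) , ∣p∣<∣p∪⁅x⁆∣ b∉)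
        where
        reach′ : ∀ {y} → y ∈ S ∪ ⁅ b ⁆ → Conn G F x y
        reach′ {y} y∈ with x∈p∪q⁻ S ⁅ b ⁆ y∈
        ... | inj₁ y∈S = reach y∈S
        ... | inj₂ y∈b rewrite x∈⁅y⁆⇒x≡y b y∈b = reach a∈ ++ Conn-edge e∈ j

    Conn? : ∀ x y → Dec (Conn G F x y)
    Conn? x y with reachable x
    ... | S , (x∈S , reach) , closed with y ∈? S
    ...   | yes y∈S = yes (reach y∈S)
    ...   | no  y∉S = no λ p → y∉S (Conn-closed closed p x∈S)

  ∈δ⁺ : ∀ {A e x y} → Joins G e x y → x ∈ A → e ∈ δ G A
  ∈δ⁺ {A} {e} j x∈A = lookup⇒[]= e (δ G A) (trans (lookup∘tabulate _ e) (ends j ([]=⇒lookup x∈A)))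
    where
    ends : ∀ {x y} → Joins G e x y → lookup A x ≡ true →
           lookup A (src G e) ∨ lookup A (tgt G e) ≡ true
    ends (inj₁ (refl , _)) x∈ = cong (_∨ lookup A (tgt G e)) x∈
    ends (inj₂ (_ , refl)) x∈ = trans (cong (lookup A (src G e) ∨_) x∈) (∨-zeroʳ _)

  ∈δ⁻ : ∀ {A e x y} → e ∈ δ G A → Joins G e x y → x ∈ A ⊎ y ∈ A
  ∈δ⁻ {A} {e} e∈ (inj₁ (refl , refl)) = ends (trans (sym (lookup∘tabulate _ e)) ([]=⇒lookup e∈))
    where
    ends : lookup A (src G e) ∨ lookup A (tgt G e) ≡ true → src G e ∈ A ⊎ tgt G e ∈ A
    ends eq with lookup A (src G e) in src∈
    ... | true  = inj₁ (lookup⇒[]= _ A src∈)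
    ... | false = inj₂ (lookup⇒[]= _ A eq)
  ∈δ⁻ e∈ (inj₂ (refl , refl)) with ∈δ⁻ e∈ (inj₁ (refl , refl))
  ... | inj₁ src∈ = inj₂ src∈
  ... | inj₂ tgt∈ = inj₁ tgt∈

  δ-mono : ∀ {A B} → A ⊆ B → δ G A ⊆ δ G B
  δ-mono A⊆B e∈ = [ ∈δ⁺ endpoints ∘ A⊆B , ∈δ⁺ (Joins-sym endpoints) ∘ A⊆B ]′ (∈δ⁻ e∈ endpoints)
    where
    endpoints = inj₁ (refl , refl)

  CoIndep-∪⁅⁆ : ∀ {I e a b} → CoIndep G I → Joins G e a b → Conn G (∁ (I ∪ ⁅ e ⁆)) a b →
                CoIndep G (I ∪ ⁅ e ⁆)
  CoIndep-∪⁅⁆ {I} {e} coindep e-ab detour f x y f-xy = reroute (coindep f x y f-xy)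
    where
    reroute : ∀ {x y} → Conn G (∁ I) x y → Conn G (∁ (I ∪ ⁅ e ⁆)) x y
    reroute here = here
    reroute (step f f∉I j p) with f ≟ᶠ e
    ... | yes refl = Conn-along e-ab j detour ++ reroute p
    ... | no  f≢e  = step f f∉I∪e j (reroute p)
      where
      f∉I∪e = x∉p⇒x∈∁p λ f∈ → [ x∈∁p⇒x∉p f∉I , f≢e ∘ x∈⁅y⁆⇒x≡y e ]′ (x∈p∪q⁻ I ⁅ e ⁆ f∈)

  coIndep? : ∀ I → Dec (CoIndep G I)
  coIndep? I = all? λ e → all? λ x → all? λ y → joins? e x y →-dec Conn? x y

  rankCond? : ∀ A → Dec (RankCond G A)
  rankCond? A = allSubset? λ I → (I ⊆? δ G A) →-dec (coIndep? I →-dec (∣ I ∣ ≤? ∣ A ∣))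

  circuit? : ∀ A → Dec (Circuit G A)
  circuit? A = nonempty? A ×-dec (rankCond? A ×-dec
    allSubset? λ B → nonempty? B →-dec ((B ⊂? A) →-dec ¬? (rankCond? B)))

  indep? : ∀ X → Dec (Indep G X)
  indep? X = allSubset? λ A → (A ⊆? X) →-dec ¬? (circuit? A)

  Indep-⊥ : Indep G Subset.⊥
  Indep-⊥ A A⊆⊥ ((x , x∈A) , _) = ∉⊥ (A⊆⊥ x∈A)

  largest-indep : ∀ A → ∃ λ J → (J ⊆ A × Indep G J) × ∀ J′ → J′ ⊆ A × Indep G J′ → ∣ J′ ∣ ≤ ∣ J ∣
  largest-indep A = largest (λ J → (J ⊆? A) ×-dec indep? J) (⊆-min A , Indep-⊥)

  incidence : Fin n → Fin m → ℕ
  incidence v e = (if does (src G e ≟ᶠ v) then 1 else 0) + (if does (tgt G e ≟ᶠ v) then 1 else 0)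

  deg≡sum-incidence : ∀ v → deg G v ≡ sum (incidence v)
  deg≡sum-incidence v = sum-allFin (incidence v)

  incidence-loop : ∀ {e w} → Joins G e w w → incidence w e ≡ 2
  incidence-loop {e} {w} (inj₁ (s , t))
    rewrite dec-true (src G e ≟ᶠ w) s | dec-true (tgt G e ≟ᶠ w) t = refl
  incidence-loop {e} {w} (inj₂ (s , t))
    rewrite dec-true (src G e ≟ᶠ w) s | dec-true (tgt G e ≟ᶠ w) t = refl

  incidence-link : ∀ {e w y} → Joins G e w y → y ≢ w → incidence w e ≡ 1
  incidence-link {e} {w} (inj₁ (s , refl)) y≢w
    rewrite dec-true (src G e ≟ᶠ w) s | dec-false (tgt G e ≟ᶠ w) y≢w = refl
  incidence-link {e} {w} (inj₂ (refl , t)) y≢w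
    rewrite dec-false (src G e ≟ᶠ w) y≢w | dec-true (tgt G e ≟ᶠ w) t = refl

  0<incidence : ∀ {e w y} → Joins G e w y → 0 < incidence w e
  0<incidence {e} {w} (inj₁ (s , _)) rewrite dec-true (src G e ≟ᶠ w) s = s≤s z≤n
  0<incidence {e} {w} (inj₂ (_ , t)) rewrite dec-true (tgt G e ≟ᶠ w) t = m≤n+m 1 _

  incidence-positive : ∀ {e w} → 0 < incidence w e → ∃ λ y → Joins G e w y
  incidence-positive {e} {w} 0<inc with src G e ≟ᶠ w | tgt G e ≟ᶠ w
  ... | yes s | _     = tgt G e , inj₁ (s , refl)
  ... | no _  | yes t = src G e , inj₂ (refl , t)
  ... | no _  | no _  with 0<inc
  ...   | ()

-- Cycle positions as natural numbers 0 … L (clamped to L beyond): E t joins V t and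
-- V (t + 1) for t < L, and E L closes the cycle from V L back to V 0.
module CycleWalk {n m} {G : Graph n m} (Z : Cycle G) where

  open GraphProperties G

  L : ℕ
  L = len Z

  position : ℕ → Fin (suc L)
  position t = fromℕ< (s≤s (m⊓n≤n t L))

  toℕ-position : ∀ {t} → t ≤ L → toℕ (position t) ≡ t
  toℕ-position t≤L = trans (toℕ-fromℕ< _) (m≤n⇒m⊓n≡m t≤L)

  position-toℕ : ∀ i → position (toℕ i) ≡ i
  position-toℕ i = toℕ-injective (toℕ-position (≤-pred (toℕ<n i)))

  position-injective : ∀ {s t} → s ≤ L → t ≤ L → position s ≡ position t → s ≡ t
  position-injective {s} {t} s≤L t≤L eq =
    trans (sym (toℕ-position s≤L)) (trans (cong toℕ eq) (toℕ-position t≤L))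

  V : ℕ → Fin n
  V t = verts Z (position t)

  E : ℕ → Fin m
  E t = edges Z (position t)

  V-injective : ∀ {s t} → s ≤ L → t ≤ L → V s ≡ V t → s ≡ t
  V-injective s≤L t≤L = position-injective s≤L t≤L ∘ verts-inj Z

  E-injective : ∀ {s t} → s ≤ L → t ≤ L → E s ≡ E t → s ≡ t
  E-injective s≤L t≤L = position-injective s≤L t≤L ∘ edges-inj Z

  joins-suc : ∀ {t} → t < L → Joins G (E t) (V t) (V (suc t))
  joins-suc {t} t<L = subst₂ (λ a b → Joins G (edges Z a) (verts Z a) (verts Z b))
    (toℕ-injective (trans (toℕ-inject₁ i) (trans (toℕ-fromℕ< t<L) (sym (toℕ-position (<⇒≤ t<L))))))
    (toℕ-injective (trans (cong suc (toℕ-fromℕ< t<L)) (sym (toℕ-position t<L))))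
    (joins-step Z i)
    where
    i = fromℕ< t<L

  joins-wrap : Joins G (E L) (V L) (V 0)
  joins-wrap = subst (λ a → Joins G (edges Z a) (verts Z a) (verts Z zero))
    (toℕ-injective (trans (toℕ-fromℕ L) (sym (toℕ-position ≤-refl))))
    (joins-last Z)

  segment : ∀ {F a b} → a ≤ b → b ≤ L → (∀ s → a ≤ s → s < b → E s ∈ F) → Conn G F (V a) (V b)
  segment {b = zero}  z≤n _    _   = here
  segment {b = suc b} a≤b′ b′≤L inF with m≤n⇒m<n∨m≡n a≤b′
  ... | inj₂ refl      = here
  ... | inj₁ (s≤s a≤b) =
    segment a≤b (<⇒≤ b′≤L) (λ s a≤s s<b → inF s a≤s (m<n⇒m<1+n s<b))
    ++ Conn-edge (inF b a≤b ≤-refl) (joins-suc b′≤L)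

  connected-to-start : ∀ {F κ t} → (∀ s → s ≤ L → s ≢ κ → E s ∈ F) → t ≤ L → Conn G F (V t) (V 0)
  connected-to-start {κ = κ} {t} others t≤L with t ≤? κ
  ... | yes t≤κ = Conn-sym (segment z≤n t≤L λ s _ s<t →
    others s (≤-trans (<⇒≤ s<t) t≤L) (<⇒≢ (<-≤-trans s<t t≤κ)))
  ... | no  t≰κ = segment t≤L ≤-refl (λ s t≤s s<L → others s (<⇒≤ s<L) (κ<⇒≢ (<-≤-trans κ<t t≤s)))
                  ++ Conn-edge (others L ≤-refl (κ<⇒≢ (<-≤-trans κ<t t≤L))) joins-wrap
    where
    κ<t = ≰⇒> t≰κ
    κ<⇒≢ : ∀ {s} → κ < s → s ≢ κ
    κ<⇒≢ κ<s = <⇒≢ κ<s ∘ sym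

  connected-without-edge : ∀ {F κ s t} → (∀ r → r ≤ L → r ≢ κ → E r ∈ F) → s ≤ L → t ≤ L →
                           Conn G F (V s) (V t)
  connected-without-edge others s≤L t≤L =
    connected-to-start others s≤L ++ Conn-sym (connected-to-start others t≤L)

  prev : ℕ → ℕ
  prev zero    = L
  prev (suc t) = t

  prev≤L : ∀ {t} → t ≤ L → prev t ≤ L
  prev≤L {zero}  _   = ≤-refl
  prev≤L {suc t} t<L = <⇒≤ t<L

  prev≢ : 0 < L → ∀ t → prev t ≢ t
  prev≢ 0<L zero    = <⇒≢ 0<L ∘ sym
  prev≢ _   (suc t) = <⇒≢ ≤-refl

  joins-prev : ∀ {t} → t ≤ L → Joins G (E (prev t)) (V (prev t)) (V t)
  joins-prev {zero}  _   = joins-wrap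
  joins-prev {suc t} t<L = joins-suc t<L

  joins-next : ∀ {t} → t ≤ L → ∃ λ u → u ≤ L × prev u ≡ t × Joins G (E t) (V t) (V u)
  joins-next t≤L with m≤n⇒m<n∨m≡n t≤L
  ... | inj₁ t<L  = suc _ , t<L , refl , joins-suc t<L
  ... | inj₂ refl = 0 , z≤n , refl , joins-wrap

  cycle-edge-at : ∀ {s t y} → s ≤ L → t ≤ L → Joins G (E s) (V t) y → s ≡ t ⊎ s ≡ prev t
  cycle-edge-at s≤L t≤L j with joins-next s≤L
  ... | u , u≤L , refl , j′ with Joins-endpoint j′ j
  ...   | inj₁ Vt≡Vs = inj₁ (sym (V-injective t≤L s≤L Vt≡Vs))
  ...   | inj₂ Vt≡Vu = inj₂ (cong prev (sym (V-injective t≤L u≤L Vt≡Vu)))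

module TrivalentTwoEdgeConnected {n m} {G : Graph n m} (triv : Trivalent G) (tec : TwoEdgeConnected G) where

  open GraphProperties G

  sum-incidence≡3 : ∀ w → sum (incidence w) ≡ 3
  sum-incidence≡3 w = trans (sym (deg≡sum-incidence w)) (triv w)

  CoIndep-⁅⁆ : ∀ e → CoIndep G ⁅ e ⁆
  CoIndep-⁅⁆ e _ x y _ = proj₂ tec e x y

  4≰3 : ¬ 4 ≤ 3
  4≰3 (s≤s (s≤s (s≤s ())))

  -- A loop uses two of the three incidences at its vertex, so the third edge would be a bridge.
  no-loop : ∀ {e w} → ¬ Joins G e w w
  no-loop {e} {w} loop with positive-elsewhere (incidence w) {e} (begin-strict
      incidence w e      ≡⟨ incidence-loop loop ⟩
      2                  <⟨ ≤-refl ⟩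
      3                  ≡⟨ sum-incidence≡3 w ⟨
      sum (incidence w)  ∎)
    where open ≤-Reasoning
  ... | e′ , e′≢e , 0<inc with incidence-positive 0<inc
  ...   | c , e′-wc = c≢w (Conn-trapped trapped (proj₂ tec e′ w c))
    where
    open ≤-Reasoning
    c≢w : c ≢ w
    c≢w refl = 4≰3 (begin
      2 + 2                          ≡⟨ cong₂ _+_ (incidence-loop loop) (incidence-loop e′-wc) ⟨
      incidence w e + incidence w e′ ≤⟨ pair≤sum (incidence w) (e′≢e ∘ sym) ⟩
      sum (incidence w)              ≡⟨ sum-incidence≡3 w ⟩
      3                              ∎)
    trapped : ∀ {f y} → f ∈ ∁ ⁅ e′ ⁆ → Joins G f w y → y ≡ w
    trapped {f} f∉e′ f-wy with f ≟ᶠ e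
    ... | yes refl = [ id , id ]′ (Joins-endpoint loop (Joins-sym f-wy))
    ... | no  f≢e  = ⊥-elim (4≰3 (begin
      2 + 1 + 1                                      ≤⟨ +-mono-≤ (+-mono-≤ (≤-reflexive (sym (incidence-loop loop))) 0<inc) (0<incidence f-wy) ⟩
      incidence w e + incidence w e′ + incidence w f ≤⟨ triple≤sum (incidence w) (e′≢e ∘ sym) (f≢e ∘ sym) e′≢f ⟩
      sum (incidence w)                              ≡⟨ sum-incidence≡3 w ⟩
      3                                              ∎))
      where
      e′≢f : e′ ≢ f
      e′≢f e′≡f = x∈∁p⇒x∉p f∉e′ (subst (_∈ ⁅ e′ ⁆) e′≡f (x∈⁅x⁆ e′))

  module _ (Z : Cycle G) where

    open CycleWalk Z

    0<len : 0 < L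
    0<len with L in L≡
    ... | suc _ = s≤s z≤n
    ... | zero  = ⊥-elim (no-loop (subst (λ t → Joins G (E t) (V t) (V 0)) L≡ joins-wrap))

    -- The two cycle edges at V κ account for two of its three incidences.
    off-cycle-edge-at : ∀ {κ} → κ ≤ L → ∃ λ e → (∀ s → s ≤ L → E s ≢ e) × ∃ λ y → Joins G e (V κ) y
    off-cycle-edge-at {κ} κ≤L with joins-next κ≤L
    ... | u , u≤L , prev-u≡κ , e₁-wu
      with positive-elsewhere₂ (incidence w) e₁≢e₂ (begin-strict
        incidence w e₁ + incidence w e₂ ≡⟨ cong₂ _+_ inc-e₁ inc-e₂ ⟩
        2                               <⟨ ≤-refl ⟩
        3                               ≡⟨ sum-incidence≡3 w ⟨
        sum (incidence w)               ∎)
      where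
      open ≤-Reasoning
      w = V κ
      e₁ = E κ
      e₂ = E (prev κ)
      inc-e₁ : incidence w e₁ ≡ 1
      inc-e₁ = incidence-link e₁-wu λ Vu≡w →
        prev≢ 0<len κ (trans (cong prev (sym (V-injective u≤L κ≤L Vu≡w))) prev-u≡κ)
      inc-e₂ : incidence w e₂ ≡ 1
      inc-e₂ = incidence-link (Joins-sym (joins-prev κ≤L)) (prev≢ 0<len κ ∘ V-injective (prev≤L κ≤L) κ≤L)
      e₁≢e₂ : e₁ ≢ e₂
      e₁≢e₂ = prev≢ 0<len κ ∘ sym ∘ E-injective κ≤L (prev≤L κ≤L)
    ... | e₃ , e₃≢e₁ , e₃≢e₂ , 0<inc with incidence-positive 0<inc
    ...   | y , e₃-wy = e₃ , off-cycle , y , e₃-wy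
      where
      off-cycle : ∀ s → s ≤ L → E s ≢ e₃
      off-cycle s s≤L refl with cycle-edge-at s≤L κ≤L e₃-wy
      ... | inj₁ refl = e₃≢e₁ refl
      ... | inj₂ refl = e₃≢e₂ refl

    -- Deleting the off-cycle edge e₃ keeps G connected, and deleting one cycle edge as well
    -- keeps the remaining cycle connected.
    coindependent-pair-at : ∀ {κ} → κ ≤ L →
      ∃ λ I → (∀ {e} → e ∈ I → ∃ λ y → Joins G e (V κ) y) × CoIndep G I × 2 ≤ ∣ I ∣
    coindependent-pair-at {κ} κ≤L with off-cycle-edge-at κ≤L | joins-next κ≤L
    ... | e₃ , off-cycle , y , e₃-wy | u , u≤L , _ , e₁-wu =
      I , at-V , CoIndep-∪⁅⁆ (CoIndep-⁅⁆ e₃) e₁-wu (connected-without-edge others κ≤L u≤L) ,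
      subst (_< ∣ I ∣) (∣⁅x⁆∣≡1 e₃) (∣p∣<∣p∪⁅x⁆∣ (off-cycle κ κ≤L ∘ x∈⁅y⁆⇒x≡y e₃))
      where
      I = ⁅ e₃ ⁆ ∪ ⁅ E κ ⁆
      at-V : ∀ {e} → e ∈ I → ∃ λ y → Joins G e (V κ) y
      at-V e∈I with x∈p∪q⁻ ⁅ e₃ ⁆ ⁅ E κ ⁆ e∈I
      ... | inj₁ e∈e₃ rewrite x∈⁅y⁆⇒x≡y e₃ e∈e₃ = y , e₃-wy
      ... | inj₂ e∈e₁ rewrite x∈⁅y⁆⇒x≡y (E κ) e∈e₁ = V u , e₁-wu
      others : ∀ s → s ≤ L → s ≢ κ → E s ∈ ∁ I
      others s s≤L s≢κ = x∉p⇒x∈∁p λ Es∈I →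
        [ off-cycle s s≤L ∘ x∈⁅y⁆⇒x≡y e₃ , s≢κ ∘ E-injective s≤L κ≤L ∘ x∈⁅y⁆⇒x≡y (E κ) ]′
        (x∈p∪q⁻ ⁅ e₃ ⁆ ⁅ E κ ⁆ Es∈I)

    module _ {A : Subset n} (Z⊆∁A : CycleIn G (∁ A) Z) where

      V∉A : ∀ t → V t ∉ A
      V∉A t = x∈∁p⇒x∉p (Z⊆∁A (position t))

      cycle-edge∉δ : ∀ {B s} → B ⊆ A → s ≤ L → E s ∉ δ G B
      cycle-edge∉δ B⊆A s≤L Es∈δB with joins-next s≤L
      ... | u , _ , _ , Es-su = [ V∉A _ ∘ B⊆A , V∉A u ∘ B⊆A ]′ (∈δ⁻ Es∈δB Es-su)

      ¬Circuit-through : ∀ {κ C} → κ ≤ L → V κ ∈ C → C ⊆ A ∪ ⁅ V κ ⁆ → ¬ Circuit G C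
      ¬Circuit-through {κ} {C} κ≤L v∈C C⊆A∪v (_ , rankC , minimal) with joins-next κ≤L
      ... | u , u≤L , _ , e₁-vu = minimal B (0<∣p∣⇒Nonempty 0<∣B∣) B⊂C rankB
        where
        v = V κ
        e₁ = E κ
        B = C ∩ A
        B⊆C : B ⊆ C
        B⊆C = p∩q⊆p C A
        B⊂C : B ⊂ C
        B⊂C = B⊆C , v , v∈C , V∉A κ ∘ p∩q⊆q C A
        C⊆v∪B : C ⊆ ⁅ v ⁆ ∪ B
        C⊆v∪B x∈C with x∈p∪q⁻ A ⁅ v ⁆ (C⊆A∪v x∈C)
        ... | inj₁ x∈A = q⊆p∪q ⁅ v ⁆ B (x∈p∩q⁺ (x∈C , x∈A))
        ... | inj₂ x∈v = p⊆p∪q B x∈v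
        ∣C∣≤1+∣B∣ : ∣ C ∣ ≤ suc ∣ B ∣
        ∣C∣≤1+∣B∣ = begin
          ∣ C ∣             ≤⟨ p⊆q⇒∣p∣≤∣q∣ C⊆v∪B ⟩
          ∣ ⁅ v ⁆ ∪ B ∣     ≤⟨ ∣p∪q∣≤∣p∣+∣q∣ ⁅ v ⁆ B ⟩
          ∣ ⁅ v ⁆ ∣ + ∣ B ∣ ≡⟨ cong (_+ ∣ B ∣) (∣⁅x⁆∣≡1 v) ⟩
          suc ∣ B ∣         ∎
          where open ≤-Reasoning
        2≤∣C∣ : 2 ≤ ∣ C ∣
        2≤∣C∣ with coindependent-pair-at κ≤L
        ... | I , at-v , coindep , 2≤∣I∣ =
          ≤-trans 2≤∣I∣ (rankC I (λ e∈I → ∈δ⁺ (proj₂ (at-v e∈I)) v∈C) coindep)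
        0<∣B∣ : 0 < ∣ B ∣
        0<∣B∣ = ≤-pred (≤-trans 2≤∣C∣ ∣C∣≤1+∣B∣)
        rankB : RankCond G B
        rankB I I⊆δB coindep =
          ≤-pred (≤-trans (∣p∣<∣p∪⁅x⁆∣ (cycle-edge∉δ (p∩q⊆q C A) κ≤L ∘ I⊆δB))
                          (≤-trans (rankC (I ∪ ⁅ e₁ ⁆) I′⊆δC coindep′) ∣C∣≤1+∣B∣))
          where
          I′⊆δC : I ∪ ⁅ e₁ ⁆ ⊆ δ G C
          I′⊆δC e∈ with x∈p∪q⁻ I ⁅ e₁ ⁆ e∈
          ... | inj₁ e∈I  = δ-mono B⊆C (I⊆δB e∈I)
          ... | inj₂ e∈e₁ rewrite x∈⁅y⁆⇒x≡y e₁ e∈e₁ = ∈δ⁺ e₁-vu v∈C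
          others : ∀ s → s ≤ L → s ≢ κ → E s ∈ ∁ (I ∪ ⁅ e₁ ⁆)
          others s s≤L s≢κ = x∉p⇒x∈∁p λ Es∈ →
            [ cycle-edge∉δ (p∩q⊆q C A) s≤L ∘ I⊆δB , s≢κ ∘ E-injective s≤L κ≤L ∘ x∈⁅y⁆⇒x≡y e₁ ]′
            (x∈p∪q⁻ I ⁅ e₁ ⁆ Es∈)
          coindep′ : CoIndep G (I ∪ ⁅ e₁ ⁆)
          coindep′ = CoIndep-∪⁅⁆ coindep e₁-vu (connected-without-edge others κ≤L u≤L)

      Indep-∪-cycle-vertex : ∀ i {J} → J ⊆ A → Indep G J → Indep G (J ∪ ⁅ verts Z i ⁆)
      Indep-∪-cycle-vertex i {J} J⊆A J-indep C C⊆J∪v circuit with verts Z i ∈? C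
      ... | no  v∉C = J-indep C (p⊆q∪⁅x⁆∧x∉p⇒p⊆q C⊆J∪v v∉C) circuit
      ... | yes v∈C = ¬Circuit-through κ≤L (subst (_∈ C) (sym Vκ≡v) v∈C)
                        (subst (λ v → C ⊆ A ∪ ⁅ v ⁆) (sym Vκ≡v) (∪-monoˡ-⊆ ⁅ verts Z i ⁆ J⊆A ∘ C⊆J∪v)) circuit
        where
        κ = toℕ i
        κ≤L : κ ≤ L
        κ≤L = ≤-pred (toℕ<n i)
        Vκ≡v : V κ ≡ verts Z i
        Vκ≡v = cong (verts Z) (position-toℕ i)

  rank-increases : ∀ (A : Subset n) v → v ∉ A →
    (Σ (Cycle G) λ Z → CycleIn G (∁ A) Z × Σ (Fin _) λ i → verts Z i ≡ v) → RankLt G A (A ∪ ⁅ v ⁆)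
  rank-increases A v v∉A (Z , Z⊆∁A , i , refl) with largest-indep A
  ... | J , (J⊆A , J-indep) , J-largest =
    J ∪ ⁅ v ⁆ , ∪-monoˡ-⊆ ⁅ v ⁆ J⊆A , Indep-∪-cycle-vertex Z Z⊆∁A i J⊆A J-indep ,
    λ J′ J′⊆A J′-indep → ≤-<-trans (J-largest J′ (J′⊆A , J′-indep)) (∣p∣<∣p∪⁅x⁆∣ (v∉A ∘ J⊆A))

  basis-complement-acyclic : ∀ (A : Subset n) → Basis G A → Acyclic G (∁ A)
  basis-complement-acyclic A (A-indep , A-maximal) (Z , Z⊆∁A) =
    x∈∁p⇒x∉p (Z⊆∁A zero)
      (A-maximal (A ∪ ⁅ v ⁆) (p⊆p∪q ⁅ v ⁆) (Indep-∪-cycle-vertex Z Z⊆∁A zero id A-indep)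
                 (q⊆p∪q A ⁅ v ⁆ (x∈⁅x⁆ v)))
    where
    v = verts Z zero

lemma4p1 : ∀ {n m : ℕ} (G : Graph n m) → Trivalent G → TwoEdgeConnected G →
    (∀ (A : Subset n) (v : Fin n) → v ∉ A →
       (Σ (Cycle G) λ C → CycleIn G (∁ A) C × Σ (Fin _) λ i → verts C i ≡ v) →
       RankLt G A (A ∪ ⁅ v ⁆))
    × (∀ (A : Subset n) → Basis G A → Acyclic G (∁ A))
lemma4p1 G triv tec = rank-increases , basis-complement-acyclic
  where open TrivalentTwoEdgeConnected triv tec
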